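{- Let $\mathbb{F}$ be any field and $A$ any $4\times 4$ matrix over $\mathbb{F}$. Then $$\det(A)=\Big(\sum_J\det(A_{\{1,2\},J})\Big)\Big(\sum_J\det(A_{\{3,4\},J})\Big)-\Big(\sum_J\det(A_{\{1,3\},J})\Big)\Big(\sum_J\det(A_{\{2,4\},J})\Big)+\Big(\sum_J\det(A_{\{1,4\},J})\Big)\Big(\sum_J\det(A_{\{2,3\},J})\Big),$$ where each sum ranges over all $2$-element subsets $J\subseteq\{1,2,3,4\}$.
   Context: For $I,J\subseteq[n]$, $A_{I,J}$ denotes the $|I|\times|J|$ submatrix of $A$ on the rows indexed by $I$ and the columns indexed by $J$ (rows and columns kept in increasing order). -}

module Defs where

open import Level using (Level; _⊔_) renaming (suc to lsuc)
open import Data.Nat using (ℕ; zero; suc)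
open import Data.Fin using (Fin; zero; suc; punchIn; _<?_)
open import Data.List using (List; []; _∷_; map; concatMap; filter; foldr; allFin)
open import Data.Product using (Σ; _×_; _,_)
open import Relation.Nullary using (¬_)
open import Algebra.Bundles using (CommutativeRing)

record Field (c ℓ : Level) : Set (lsuc (c ⊔ ℓ)) where
  field
    commutativeRing : CommutativeRing c ℓ
  open CommutativeRing commutativeRing public hiding (zero)
  field
    0≉1     : ¬ (0# ≈ 1#)
    inverse : ∀ x → ¬ (x ≈ 0#) → Σ Carrier λ y → x * y ≈ 1#

Matrix : ∀ {a} → Set a → ℕ → ℕ → Set a
Matrix A m n = Fin m → Fin n → A

-- Submatrix A_{I,J} where I, J are given by their elements listed in
-- increasing order (an index map Fin k → Fin n).
submatrix : ∀ {a} {A : Set a} {m n k l : ℕ} →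
            Matrix A m n → (Fin k → Fin m) → (Fin l → Fin n) → Matrix A k l
submatrix M I J i j = M (I i) (J j)

pair : ∀ {n} → Fin n → Fin n → Fin 2 → Fin n
pair i j zero    = i
pair i j (suc _) = j

twoSubsets : (n : ℕ) → List (Fin 2 → Fin n)
twoSubsets n = concatMap (λ i → map (pair i) (filter (i <?_) (allFin n))) (allFin n)

module _ {c ℓ} (R : CommutativeRing c ℓ) where
  open CommutativeRing R using (Carrier; _+_; _-_; _*_; 0#; 1#)

  sumList : List Carrier → Carrier
  sumList = foldr _+_ 0#

  altSum : ∀ {n} → (Fin n → Carrier) → Carrier
  altSum {zero}  f = 0#
  altSum {suc n} f = f zero - altSum (λ j → f (suc j))

  det : ∀ {n} → Matrix Carrier n n → Carrier
  det {zero}  M = 1#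
  det {suc n} M = altSum (λ j → M zero j * det (λ i k → M (suc i) (punchIn j k)))

{-# OPTIONS --safe #-}
module Submission where

open import Defs
open import Algebra.Bundles using (CommutativeRing)
open import Algebra.Solver.Ring.AlmostCommutativeRing
  using (fromCommutativeRing; _-Raw-AlmostCommutative⟶_)
open import Data.Fin using (Fin; zero; suc; punchIn; combine; remQuot)
open import Data.Integer as ℤ using (ℤ; +_; +0; +[1+_]; -[1+_]; _⊖_)
import Data.Integer.Properties as ℤ
open import Data.List using (List; map; foldr)
open import Data.Maybe as Maybe using (Maybe)
open import Data.Nat as ℕ using (ℕ)
import Data.Nat.Properties as ℕ
open import Data.Product using (uncurry)
open import Data.Sign as Sign using (Sign)
open import Data.Vec using (Vec; tabulate)
open import Function using (_∘_; id)
open import Relation.Binary.PropositionalEquality using (cong)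
open import Relation.Nullary.Decidable using (dec⇒maybe)

-- Both sides are polynomials with integer coefficients in the sixteen
-- entries of A, and they agree, so the identity holds in every commutative
-- ring; the ring solver checks it with
-- integer coefficients, read in the ring through the canonical map ℤ → R.
-- Conceptually, S_{ik} = Σ_{j<l} (a_ij a_kl − a_il a_kj) is the (i, k) entry
-- of A K Aᵀ, where K is the skew matrix with K_jl = 1 for j < l, and the
-- right-hand side is Pf(A K Aᵀ) = det A · Pf K = det A.

module IntegerCast {c ℓ} (R : CommutativeRing c ℓ) where
  open CommutativeRing R hiding (zero)
  open import Algebra.Properties.Ring ring
  open import Algebra.Properties.Semiring.Mult.TCOptimised semiring
  open import Relation.Binary.Reasoning.Setoid setoid

  ⟦_⟧ℤ : ℤ → Carrier
  ⟦ + n ⟧ℤ      = n × 1#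
  ⟦ -[1+ n ] ⟧ℤ = - (ℕ.suc n × 1#)

  -‿homo : ∀ i → ⟦ ℤ.- i ⟧ℤ ≈ - ⟦ i ⟧ℤ
  -‿homo +0         = sym -0#≈0#
  -‿homo +[1+ n ]   = refl
  -‿homo -[1+ n ]   = sym (-‿involutive _)

  ⊖-homo : ∀ m n → ⟦ m ⊖ n ⟧ℤ ≈ m × 1# - n × 1#
  ⊖-homo m           ℕ.zero      = sym (trans (+-congˡ -0#≈0#) (+-identityʳ _))
  ⊖-homo ℕ.zero      (ℕ.suc n)   = sym (+-identityˡ _)
  ⊖-homo (ℕ.suc m)   (ℕ.suc n)   = begin
    ⟦ ℕ.suc m ⊖ ℕ.suc n ⟧ℤ           ≡⟨ cong ⟦_⟧ℤ (ℤ.[1+m]⊖[1+n]≡m⊖n m n) ⟩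
    ⟦ m ⊖ n ⟧ℤ                       ≈⟨ ⊖-homo m n ⟩
    m × 1# - n × 1#                  ≈⟨ cancel-common-summand 1# (m × 1#) (n × 1#) ⟨
    (1# + m × 1#) - (1# + n × 1#)    ≈⟨ +-cong (1+× m 1#) (-‿cong (1+× n 1#)) ⟨
    ℕ.suc m × 1# - ℕ.suc n × 1#      ∎
    where
    cancel-common-summand : ∀ a x y → (a + x) - (a + y) ≈ x - y
    cancel-common-summand a x y = begin
      (a + x) - (a + y)      ≈⟨ +-congˡ (-‿+-comm a y) ⟨
      (a + x) + (- a - y)    ≈⟨ +-assoc (a + x) (- a) (- y) ⟨
      (a + x - a) - y        ≈⟨ +-congʳ (xyx⁻¹≈y a x) ⟩
      x - y                  ∎

  +-homo : ∀ i j → ⟦ i ℤ.+ j ⟧ℤ ≈ ⟦ i ⟧ℤ + ⟦ j ⟧ℤ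
  +-homo (+ m)      (+ n)      = ×-homo-+ 1# m n
  +-homo (+ m)      -[1+ n ]   = ⊖-homo m (ℕ.suc n)
  +-homo -[1+ m ]   (+ n)      = trans (⊖-homo n (ℕ.suc m)) (+-comm _ _)
  +-homo -[1+ m ]   -[1+ n ]   = begin
    - (ℕ.suc (ℕ.suc (m ℕ.+ n)) × 1#)       ≡⟨ cong (λ k → - (ℕ.suc k × 1#)) (ℕ.+-suc m n) ⟨
    - ((ℕ.suc m ℕ.+ ℕ.suc n) × 1#)         ≈⟨ -‿cong (×-homo-+ 1# (ℕ.suc m) (ℕ.suc n)) ⟩
    - (ℕ.suc m × 1# + ℕ.suc n × 1#)        ≈⟨ -‿+-comm _ _ ⟨
    - (ℕ.suc m × 1#) + - (ℕ.suc n × 1#)    ∎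

  signed : Sign → Carrier → Carrier
  signed Sign.+ x = x
  signed Sign.- x = - x

  signed-cong : ∀ s {x y} → x ≈ y → signed s x ≈ signed s y
  signed-cong Sign.+ = id
  signed-cong Sign.- = -‿cong

  signed-homo-* : ∀ s t x y → signed (s Sign.* t) (x * y) ≈ signed s x * signed t y
  signed-homo-* Sign.+ Sign.+ x y = refl
  signed-homo-* Sign.+ Sign.- x y = -‿distribʳ-* x y
  signed-homo-* Sign.- Sign.+ x y = -‿distribˡ-* x y
  signed-homo-* Sign.- Sign.- x y = begin
    x * y          ≈⟨ -‿involutive (x * y) ⟨
    - - (x * y)    ≈⟨ -‿cong (-‿distribˡ-* x y) ⟩
    - (- x * y)    ≈⟨ -‿distribʳ-* (- x) y ⟩
    - x * - y      ∎

  ⟦⟧ℤ-◃ : ∀ s n → ⟦ s ℤ.◃ n ⟧ℤ ≈ signed s (n × 1#)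
  ⟦⟧ℤ-◃ Sign.+ ℕ.zero      = refl
  ⟦⟧ℤ-◃ Sign.- ℕ.zero      = sym -0#≈0#
  ⟦⟧ℤ-◃ Sign.+ (ℕ.suc n)   = refl
  ⟦⟧ℤ-◃ Sign.- (ℕ.suc n)   = refl

  ⟦⟧ℤ-signAbs : ∀ i → ⟦ i ⟧ℤ ≈ signed (ℤ.sign i) (ℤ.∣ i ∣ × 1#)
  ⟦⟧ℤ-signAbs (+ n)      = refl
  ⟦⟧ℤ-signAbs -[1+ n ]   = refl

  *-homo : ∀ i j → ⟦ i ℤ.* j ⟧ℤ ≈ ⟦ i ⟧ℤ * ⟦ j ⟧ℤ
  *-homo i j = begin
    ⟦ s Sign.* t ℤ.◃ ∣i∣ ℕ.* ∣j∣ ⟧ℤ                 ≈⟨ ⟦⟧ℤ-◃ (s Sign.* t) (∣i∣ ℕ.* ∣j∣) ⟩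
    signed (s Sign.* t) ((∣i∣ ℕ.* ∣j∣) × 1#)         ≈⟨ signed-cong (s Sign.* t) (×1-homo-* ∣i∣ ∣j∣) ⟩
    signed (s Sign.* t) (∣i∣ × 1# * ∣j∣ × 1#)        ≈⟨ signed-homo-* s t _ _ ⟩
    signed s (∣i∣ × 1#) * signed t (∣j∣ × 1#)        ≈⟨ *-cong (⟦⟧ℤ-signAbs i) (⟦⟧ℤ-signAbs j) ⟨
    ⟦ i ⟧ℤ * ⟦ j ⟧ℤ                                  ∎
    where
    s = ℤ.sign i
    t = ℤ.sign j
    ∣i∣ = ℤ.∣ i ∣
    ∣j∣ = ℤ.∣ j ∣

  ℤ⟶R : ℤ.+-*-rawRing -Raw-AlmostCommutative⟶ fromCommutativeRing R
  ℤ⟶R = record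
    { ⟦_⟧    = ⟦_⟧ℤ
    ; +-homo = +-homo
    ; *-homo = *-homo
    ; -‿homo = -‿homo
    ; 0-homo = refl
    ; 1-homo = refl
    }

  ⟦⟧ℤ-≟ : ∀ i j → Maybe (⟦ i ⟧ℤ ≈ ⟦ j ⟧ℤ)
  ⟦⟧ℤ-≟ i j = Maybe.map (reflexive ∘ cong ⟦_⟧ℤ) (dec⇒maybe (i ℤ.≟ j))

module _ {c ℓ} (R : CommutativeRing c ℓ) where
  open CommutativeRing R using (Carrier; _≈_; _+_; _-_; _*_; refl)
  open IntegerCast R using (ℤ⟶R; ⟦⟧ℤ-≟)
  open import Algebra.Solver.Ring ℤ.+-*-rawRing (fromCommutativeRing R) ℤ⟶R ⟦⟧ℤ-≟

  sumOfMinors : ∀ {m n} → Matrix Carrier m n → (Fin 2 → Fin m) → Carrier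
  sumOfMinors {n = n} A I = sumList R (map (λ J → det R (submatrix A I J)) (twoSubsets n))

  private
    variable
      k : ℕ

    sumListₚ : List (Polynomial k) → Polynomial k
    sumListₚ = foldr _:+_ (con (+ 0))

    altSumₚ : ∀ {n} → (Fin n → Polynomial k) → Polynomial k
    altSumₚ {n = ℕ.zero}  f = con (+ 0)
    altSumₚ {n = ℕ.suc n} f = f zero :- altSumₚ (λ j → f (suc j))

    detₚ : ∀ {n} → Matrix (Polynomial k) n n → Polynomial k
    detₚ {n = ℕ.zero}  M = con (+ 1)
    detₚ {n = ℕ.suc n} M = altSumₚ (λ j → M zero j :* detₚ (λ i l → M (suc i) (punchIn j l)))

    sumOfMinorsₚ : ∀ {m n} → Matrix (Polynomial k) m n → (Fin 2 → Fin m) → Polynomial k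
    sumOfMinorsₚ {n = n} A I = sumListₚ (map (λ J → detₚ (submatrix A I J)) (twoSubsets n))

    generic : ∀ {m n} → Matrix (Polynomial (m ℕ.* n)) m n
    generic i j = var (combine i j)

    entries : ∀ {m n} → Matrix Carrier m n → Vec Carrier (m ℕ.* n)
    entries {m} {n} A = tabulate (uncurry A ∘ remQuot n)

    r1 r2 r3 r4 : Fin 4
    r1 = zero
    r2 = suc zero
    r3 = suc (suc zero)
    r4 = suc (suc (suc zero))

  det₄≈pfaffian-sumOfMinors : (A : Matrix Carrier 4 4) →
    let S = sumOfMinors A in
    det R A ≈ (S (pair r1 r2) * S (pair r3 r4) - S (pair r1 r3) * S (pair r2 r4))
              + S (pair r1 r4) * S (pair r2 r3)
  -- ⟦_⟧ commutes with the formal operations by definition and `entries A`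
  -- sends the variable of each closed index (i, j) to A i j, so this
  -- instance of `prove` is, after normalisation, the identity for A.
  det₄≈pfaffian-sumOfMinors A = prove (entries A) (detₚ X) pfaffianₚ refl
    where
    X : Matrix (Polynomial 16) 4 4
    X = generic
    Sₚ : (Fin 2 → Fin 4) → Polynomial 16
    Sₚ = sumOfMinorsₚ X
    pfaffianₚ : Polynomial 16
    pfaffianₚ = (Sₚ (pair r1 r2) :* Sₚ (pair r3 r4) :- Sₚ (pair r1 r3) :* Sₚ (pair r2 r4))
                :+ Sₚ (pair r1 r4) :* Sₚ (pair r2 r3)

theorem3p5 : ∀ {c ℓ} (F : Field c ℓ) (A : Matrix (Field.Carrier F) 4 4) →
    let open Field F
        D = det commutativeRing
        S : (Fin 2 → Fin 4) → Carrier
        S I = sumList commutativeRing (map (λ J → D (submatrix A I J)) (twoSubsets 4))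
        r1 = zero
        r2 = suc zero
        r3 = suc (suc zero)
        r4 = suc (suc (suc zero))
    in D A ≈ (S (pair r1 r2) * S (pair r3 r4) - S (pair r1 r3) * S (pair r2 r4))
             + S (pair r1 r4) * S (pair r2 r3)
theorem3p5 F = det₄≈pfaffian-sumOfMinors (Field.commutativeRing F)
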